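{- Let $\mathfrak P$ be a well-founded upwards linear partial order. Every element of $\mathfrak P$ is contained in a unique maximal branching free interval.
   Context: A partial order $(P,\le)$ is upwards linear if for every $p$ the set $\{a\mid p<a\}$ is linearly ordered, and well-founded if it has no infinite strictly descending chain. Adjoin a symbol $\infty$ with $p<\infty$ for all $p\in P$. For $p_1\in P$ and $p_2\in P\cup\{\infty\}$ with $p_1\le p_2$, the interval $[p_1,p_2)=\{p\in P\mid p_1\le p<p_2\}$ is branching free if for every $p\in[p_1,p_2)$ and every $x<p$, the elements $x$ and $p_1$ are comparable. A branching free interval is maximal branching free if it is maximal with respect to set inclusion among branching free intervals. -}

module Defs where

open import Level using (Level; _⊔_)
open import Data.Product using (_×_; Σ-syntax; ∃-syntax; _,_)
open import Data.Sum using (_⊎_)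
open import Data.Unit.Polymorphic using (⊤)
open import Data.Maybe using (Maybe; just; nothing)
open import Relation.Nullary using (¬_)
open import Relation.Binary.Bundles using (Poset)
open import Induction.WellFounded using (WellFounded)

module PosetDefs {c ℓ₁ ℓ₂ : Level} (𝔓 : Poset c ℓ₁ ℓ₂) where
  open Poset 𝔓 renaming (Carrier to P)

  _<_ : P → P → Set (ℓ₁ ⊔ ℓ₂)
  x < y = x ≤ y × ¬ (x ≈ y)

  Comparable : P → P → Set ℓ₂
  Comparable x y = x ≤ y ⊎ y ≤ x

  UpwardsLinear : Set (c ⊔ ℓ₁ ⊔ ℓ₂)
  UpwardsLinear = ∀ p a b → p < a → p < b → Comparable a b

  WellFoundedPoset : Set (c ⊔ ℓ₁ ⊔ ℓ₂)
  WellFoundedPoset = WellFounded _<_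

  -- P ∪ {∞}: nothing = ∞, with p < ∞ for all p
  P∞ : Set c
  P∞ = Maybe P

  _<∞_ : P → P∞ → Set (ℓ₁ ⊔ ℓ₂)
  p <∞ nothing = ⊤
  p <∞ just q  = p < q

  _≤∞_ : P → P∞ → Set ℓ₂
  p ≤∞ nothing = ⊤
  p ≤∞ just q  = p ≤ q

  -- an interval [p₁ , p₂) with p₁ ∈ P, p₂ ∈ P ∪ {∞}, p₁ ≤ p₂
  record Interval : Set (c ⊔ ℓ₂) where
    constructor interval
    field
      lower : P
      upper : P∞
      lower≤upper : lower ≤∞ upper
  open Interval public

  _∈I_ : P → Interval → Set (ℓ₁ ⊔ ℓ₂)
  p ∈I I = lower I ≤ p × p <∞ upper I

  _⊆I_ : Interval → Interval → Set (c ⊔ ℓ₁ ⊔ ℓ₂)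
  I ⊆I J = ∀ p → p ∈I I → p ∈I J

  _≐I_ : Interval → Interval → Set (c ⊔ ℓ₁ ⊔ ℓ₂)
  I ≐I J = I ⊆I J × J ⊆I I

  BranchingFree : Interval → Set (c ⊔ ℓ₁ ⊔ ℓ₂)
  BranchingFree I = ∀ p → p ∈I I → ∀ x → x < p → Comparable x (lower I)

  MaximalBranchingFree : Interval → Set (c ⊔ ℓ₁ ⊔ ℓ₂)
  MaximalBranchingFree I =
    BranchingFree I × (∀ J → BranchingFree J → I ⊆I J → J ⊆I I)

-- Call [q, p] closed branching free if q ≤ p and no y ∈ [q, p] has a predecessor
-- incomparable with q.  Well-foundedness gives a minimal such q =: p₁, and the
-- property of any other such q, applied at y = p and x = p₁, shows p₁ ≤ q.
-- Let p₂ be a minimal branch point over p₁, i.e. a point above p₁ with a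
-- predecessor incomparable with p₁ (or ∞ if there is none); every branch point
-- lies above p, and by upwards linearity every point above p₁ not above p₂ is
-- below p₂.  Then [p₁, p₂) is branching free, contains p, and contains every
-- branching free J ∋ p: [lower J, p] is closed branching free, so lower J ≥ p₁,
-- and J cannot reach p₂, since the bad predecessor of p₂ would have to be
-- comparable with lower J.  A greatest branching free interval around p is its
-- unique maximal one.
module Submission where

open import Defs
import Level
open import Level using (Level; _⊔_; Lift; lift)
open import Data.Product using (_×_; ∃-syntax; _,_; proj₁; proj₂)
open import Data.Sum using (inj₁; inj₂)
open import Data.Maybe using (just; nothing)
open import Data.Unit.Polymorphic using (⊤; tt)
open import Data.Empty using (⊥-elim)
open import Relation.Nullary using (¬_; yes; no)
open import Relation.Nullary.Decidable using (map′)
open import Relation.Unary using (Pred)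
open import Relation.Binary.Core using (Rel)
open import Relation.Binary.Bundles using (Poset)
open import Axiom.ExcludedMiddle using (ExcludedMiddle)
open import Induction.WellFounded using (WellFounded; Acc; acc)

private variable a b q r : Level

lower-em : ExcludedMiddle (a ⊔ b) → ExcludedMiddle a
lower-em {b = b} em = map′ Level.lower lift (em {Lift b _})

module _ {A : Set a} {_<_ : Rel A r} (em : ExcludedMiddle (a ⊔ r ⊔ q)) (wf : WellFounded _<_) where

  wf-minimal : (Q : Pred A q) → ∀ {x} → Q x → ∃[ m ] (Q m × (∀ {y} → Q y → ¬ y < m))
  wf-minimal Q {x} = go (wf x)
    where
    go : ∀ {x} → Acc _<_ x → Q x → ∃[ m ] (Q m × (∀ {y} → Q y → ¬ y < m))
    go {x} (acc rs) qx with em {∃[ y ] (Q y × y < x)}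
    ... | yes (y , qy , y<x) = go (rs y<x) qy
    ... | no ∄y = x , qx , λ qy y<x → ∄y (_ , qy , y<x)

module PosetProperties {c ℓ₁ ℓ₂} (𝔓 : Poset c ℓ₁ ℓ₂) where
  open PosetDefs 𝔓
  open Poset 𝔓 renaming (Carrier to P)

  ClosedBranchingFree : P → P → Set (c ⊔ ℓ₁ ⊔ ℓ₂)
  ClosedBranchingFree l u = l ≤ u × (∀ y → l ≤ y → y ≤ u → ∀ x → x < y → Comparable x l)

  BranchPoint : P → P → Set (c ⊔ ℓ₁ ⊔ ℓ₂)
  BranchPoint l y = l ≤ y × ∃[ x ] (x < y × ¬ Comparable x l)

  ≤-<∞-trans : ∀ {x y w} → x ≤ y → y <∞ w → x <∞ w
  ≤-<∞-trans {w = nothing} _ _ = tt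
  ≤-<∞-trans {w = just u} x≤y (y≤u , y≉u) =
    trans x≤y y≤u , λ x≈u → y≉u (antisym y≤u (trans (reflexive (Eq.sym x≈u)) x≤y))

  closedBranchingFree-refl : ∀ u → ClosedBranchingFree u u
  closedBranchingFree-refl u = refl , λ y _ y≤u x x<y → inj₁ (trans (proj₁ x<y) y≤u)

  closedBranchingFree⇒¬branchPoint : ∀ {l u y} → ClosedBranchingFree l u →
    y ≤ u → ¬ BranchPoint l y
  closedBranchingFree⇒¬branchPoint (_ , cbf) y≤u (l≤y , x , x<y , x∦l) = x∦l (cbf _ l≤y y≤u x x<y)

  branchPoint⇒< : ∀ {l y} → BranchPoint l y → l < y
  branchPoint⇒< (l≤y , x , x<y , x∦l) =
    l≤y , λ l≈y → x∦l (inj₁ (trans (proj₁ x<y) (reflexive (Eq.sym l≈y))))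

  branchingFree⇒closedBranchingFree : ∀ J {u} → BranchingFree J → u ∈I J →
    ClosedBranchingFree (lower J) u
  branchingFree⇒closedBranchingFree J bf (l≤u , u<∞) =
    l≤u , λ y l≤y y≤u → bf y (l≤y , ≤-<∞-trans y≤u u<∞)

  upwardsLinear⇒< : ExcludedMiddle ℓ₁ → UpwardsLinear →
    ∀ {l y z} → l < y → l ≤ z → ¬ y ≤ z → z < y
  upwardsLinear⇒< em ul {l} {y} {z} l<y l≤z y≰z = z≤y , λ z≈y → y≰z (reflexive (Eq.sym z≈y))
    where
    z≤y : z ≤ y
    z≤y with em {z ≈ l}
    ... | yes z≈l = trans (reflexive z≈l) (proj₁ l<y)
    ... | no z≉l with ul l z y (l≤z , λ l≈z → z≉l (Eq.sym l≈z)) l<y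
    ...   | inj₁ z≤y = z≤y
    ...   | inj₂ y≤z = ⊥-elim (y≰z y≤z)

  greatest⇒uniqueMaximal : ∀ {p} I → BranchingFree I → p ∈I I →
    (∀ J → BranchingFree J → p ∈I J → J ⊆I I) →
    (∃[ I ] (MaximalBranchingFree I × p ∈I I))
    × (∀ I J → MaximalBranchingFree I → p ∈I I → MaximalBranchingFree J → p ∈I J → I ≐I J)
  greatest⇒uniqueMaximal {p} I bf p∈I greatest =
    (I , (bf , λ J bfJ I⊆J → greatest J bfJ (I⊆J _ p∈I)) , p∈I) , λ J K mJ p∈J mK p∈K →
      let (J⊆I , I⊆J) = ≐greatest J mJ p∈J
          (K⊆I , I⊆K) = ≐greatest K mK p∈K
      in (λ z z∈J → I⊆K z (J⊆I z z∈J)) , (λ z z∈K → I⊆J z (K⊆I z z∈K))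
    where
    ≐greatest : ∀ J → MaximalBranchingFree J → p ∈I J → J ≐I I
    ≐greatest J (bfJ , maxJ) p∈J = let J⊆I = greatest J bfJ p∈J in J⊆I , maxJ I bf J⊆I

module MaximalInterval {c ℓ₁ ℓ₂} (em : ExcludedMiddle (c ⊔ ℓ₁ ⊔ ℓ₂)) (𝔓 : Poset c ℓ₁ ℓ₂)
  (wf : PosetDefs.WellFoundedPoset 𝔓) (ul : PosetDefs.UpwardsLinear 𝔓) (p : Poset.Carrier 𝔓) where
  open PosetDefs 𝔓
  open PosetProperties 𝔓
  open Poset 𝔓 renaming (Carrier to P)

  em≈ : ExcludedMiddle ℓ₁
  em≈ = lower-em {b = c ⊔ ℓ₂} em

  em≤ : ExcludedMiddle ℓ₂
  em≤ = lower-em {b = c ⊔ ℓ₁} em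

  minimalLowerEnd : ∃[ m ] (ClosedBranchingFree m p × (∀ {y} → ClosedBranchingFree y p → ¬ y < m))
  minimalLowerEnd = wf-minimal em wf (λ m → ClosedBranchingFree m p) (closedBranchingFree-refl p)

  p₁ : P
  p₁ = proj₁ minimalLowerEnd

  p₁-cbf : ClosedBranchingFree p₁ p
  p₁-cbf = proj₁ (proj₂ minimalLowerEnd)

  p₁-minimal : ∀ {l} → ClosedBranchingFree l p → ¬ l < p₁
  p₁-minimal = proj₂ (proj₂ minimalLowerEnd)

  p₁≤p : p₁ ≤ p
  p₁≤p = proj₁ p₁-cbf

  p₁-least : ∀ {l} → ClosedBranchingFree l p → p₁ ≤ l
  p₁-least {l} l-cbf = resolve p₁∼l
    where
    p₁∼l : Comparable p₁ l
    p₁∼l with em≈ {p₁ ≈ p}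
    ... | yes p₁≈p = inj₂ (trans (proj₁ l-cbf) (reflexive (Eq.sym p₁≈p)))
    ... | no p₁≉p = proj₂ l-cbf p (proj₁ l-cbf) refl p₁ (p₁≤p , p₁≉p)

    resolve : Comparable p₁ l → p₁ ≤ l
    resolve (inj₁ p₁≤l) = p₁≤l
    resolve (inj₂ l≤p₁) with em≈ {l ≈ p₁}
    ... | yes l≈p₁ = reflexive (Eq.sym l≈p₁)
    ... | no l≉p₁ = ⊥-elim (p₁-minimal l-cbf (l≤p₁ , l≉p₁))

  branchPoint⇒p< : ∀ {y} → BranchPoint p₁ y → p < y
  branchPoint⇒p< {y} by with em≤ {y ≤ p}
  ... | yes y≤p = ⊥-elim (closedBranchingFree⇒¬branchPoint p₁-cbf y≤p by)
  ... | no y≰p = upwardsLinear⇒< em≈ ul (branchPoint⇒< by) p₁≤p y≰p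

  module _ (J : Interval) (bfJ : BranchingFree J) (p∈J : p ∈I J) where

    p₁≤lower : p₁ ≤ lower J
    p₁≤lower = p₁-least (branchingFree⇒closedBranchingFree J bfJ p∈J)

    branchPoint∉ : ∀ {y} → BranchPoint p₁ y → ¬ y ∈I J
    branchPoint∉ (_ , x , x<y , x∦p₁) y∈J with bfJ _ y∈J x x<y
    ... | inj₂ l≤x = x∦p₁ (inj₂ (trans p₁≤lower l≤x))
    ... | inj₁ x≤l with em≈ {x ≈ lower J}
    ...   | yes x≈l = x∦p₁ (inj₂ (trans p₁≤lower (reflexive (Eq.sym x≈l))))
    ...   | no x≉l = x∦p₁ (proj₂ p₁-cbf (lower J) p₁≤lower (proj₁ p∈J) x (x≤l , x≉l))

    <branchPoint : ∀ {y z} → BranchPoint p₁ y → z ∈I J → z < y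
    <branchPoint {y} {z} by z∈J with em≤ {y ≤ z}
    ... | yes y≤z = ⊥-elim (branchPoint∉ by (l≤y , ≤-<∞-trans y≤z (proj₂ z∈J)))
      where
      l≤y : lower J ≤ y
      l≤y = trans (proj₁ p∈J) (proj₁ (branchPoint⇒p< by))
    ... | no y≰z = upwardsLinear⇒< em≈ ul (branchPoint⇒< by) (trans p₁≤lower (proj₁ z∈J)) y≰z

  BranchPoint∞ : P∞ → Set (c ⊔ ℓ₁ ⊔ ℓ₂)
  BranchPoint∞ nothing = ⊤
  BranchPoint∞ (just y) = BranchPoint p₁ y

  NoBranchPointBefore : P∞ → Set (c ⊔ ℓ₁ ⊔ ℓ₂)
  NoBranchPointBefore w = ∀ {y} → p₁ ≤ y → y <∞ w → ¬ BranchPoint p₁ y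

  firstBranchPoint : ∃[ w ] (BranchPoint∞ w × NoBranchPointBefore w)
  firstBranchPoint with em {∃[ y ] BranchPoint p₁ y}
  ... | yes (_ , by) = let (m , bm , m-minimal) = wf-minimal em wf (BranchPoint p₁) by
                       in just m , bm , λ _ y<m by → m-minimal by y<m
  ... | no ∄y = nothing , tt , λ _ _ by → ∄y (_ , by)

  p₁≤∞branchPoint : ∀ w → BranchPoint∞ w → p₁ ≤∞ w
  p₁≤∞branchPoint nothing _ = tt
  p₁≤∞branchPoint (just _) (p₁≤y , _) = p₁≤y

  p<∞branchPoint : ∀ w → BranchPoint∞ w → p <∞ w
  p<∞branchPoint nothing _ = tt
  p<∞branchPoint (just _) by = branchPoint⇒p< by

  <∞branchPoint : ∀ J → BranchingFree J → p ∈I J → ∀ w → BranchPoint∞ w → ∀ {z} → z ∈I J → z <∞ w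
  <∞branchPoint _ _ _ nothing _ _ = tt
  <∞branchPoint J bfJ p∈J (just _) by z∈J = <branchPoint J bfJ p∈J by z∈J

  branchingFree-upTo : ∀ {w} → NoBranchPointBefore w → (p₁≤w : p₁ ≤∞ w) →
    BranchingFree (interval p₁ w p₁≤w)
  branchingFree-upTo noBranch _ y (p₁≤y , y<w) x x<y with em≤ {Comparable x p₁}
  ... | yes x∼p₁ = x∼p₁
  ... | no x∦p₁ = ⊥-elim (noBranch p₁≤y y<w (p₁≤y , x , x<y , x∦p₁))

  uniqueMaximal : (∃[ I ] (MaximalBranchingFree I × p ∈I I))
    × (∀ I J → MaximalBranchingFree I → p ∈I I → MaximalBranchingFree J → p ∈I J → I ≐I J)
  uniqueMaximal with firstBranchPoint
  ... | w , bw , noBranch =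
    greatest⇒uniqueMaximal I (branchingFree-upTo noBranch p₁≤w) (p₁≤p , p<∞branchPoint w bw) greatest
    where
    p₁≤w : p₁ ≤∞ w
    p₁≤w = p₁≤∞branchPoint w bw

    I : Interval
    I = interval p₁ w p₁≤w

    greatest : ∀ J → BranchingFree J → p ∈I J → J ⊆I I
    greatest J bfJ p∈J z z∈J =
      trans (p₁≤lower J bfJ p∈J) (proj₁ z∈J) , <∞branchPoint J bfJ p∈J w bw z∈J

lemma2p5 : ∀ {c ℓ₁ ℓ₂} → ExcludedMiddle (c ⊔ ℓ₁ ⊔ ℓ₂) → (𝔓 : Poset c ℓ₁ ℓ₂) →
    let open PosetDefs 𝔓 in
    WellFoundedPoset → UpwardsLinear → ∀ p →
    (∃[ I ] (MaximalBranchingFree I × p ∈I I))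
    × (∀ I J → MaximalBranchingFree I → p ∈I I → MaximalBranchingFree J → p ∈I J → I ≐I J)
lemma2p5 em 𝔓 wf ul p = MaximalInterval.uniqueMaximal em 𝔓 wf ul p
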